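{- For any positive integers $k\geq 2$ and $\omega$ such that $\omega$ is divisible by $2k-1$, there exists a finite simple graph $G$ with $\theta(G)=k$ and clique number $\omega(G)=\omega$ such that $\varphi(G)=\frac{k^2\omega}{2k-1}$.
   Context: $\theta(G)$ is the minimum number of parts in a partition of $V(G)$ into subsets each inducing a complete subgraph. $\omega(G)$ is the largest order of a complete subgraph of $G$. A $b$-coloring of $G$ with $b$ colors is a proper coloring of $V(G)$ using exactly $b$ colors such that for every color $i$ there is a vertex of color $i$ having neighbors of all the other $b-1$ colors. The $b$-chromatic number $\varphi(G)$ is the largest $b$ for which such a coloring exists. -}

module Defs where

open import Data.Nat using (ℕ; _≤_)
open import Data.Fin using (Fin)
open import Data.Product using (Σ; ∃; _×_; _,_)
open import Relation.Binary.PropositionalEquality using (_≡_)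
open import Relation.Nullary using (¬_)
open import Level using (0ℓ)

record Graph : Set₁ where
  field
    n     : ℕ
    Adj   : Fin n → Fin n → Set
    sym   : ∀ {u v} → Adj u v → Adj v u
    irrefl : ∀ {v} → ¬ Adj v v

open Graph public

IsClique : (G : Graph) {m : ℕ} → (Fin m → Fin (n G)) → Set
IsClique G {m} f = ∀ (i j : Fin m) → ¬ i ≡ j → Adj G (f i) (f j)

HasCliqueOfSize : Graph → ℕ → Set
HasCliqueOfSize G m = Σ (Fin m → Fin (n G)) λ f → IsClique G f

CliqueNumber : Graph → ℕ → Set
CliqueNumber G w = HasCliqueOfSize G w × (∀ m → HasCliqueOfSize G m → m ≤ w)

IsCliquePartition : (G : Graph) (k : ℕ) → (Fin (n G) → Fin k) → Set
IsCliquePartition G k p =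
  (∀ u v → p u ≡ p v → ¬ u ≡ v → Adj G u v) × (∀ (i : Fin k) → ∃ λ v → p v ≡ i)

HasCliquePartition : Graph → ℕ → Set
HasCliquePartition G k = Σ (Fin (n G) → Fin k) λ p → IsCliquePartition G k p

CliqueCoverNumber : Graph → ℕ → Set
CliqueCoverNumber G k = HasCliquePartition G k × (∀ m → HasCliquePartition G m → k ≤ m)

IsBColoring : (G : Graph) (b : ℕ) → (Fin (n G) → Fin b) → Set
IsBColoring G b c =
  (∀ u v → Adj G u v → ¬ c u ≡ c v)
  × (∀ (i : Fin b) → ∃ λ v → c v ≡ i)
  × (∀ (i : Fin b) → ∃ λ v → c v ≡ i
        × (∀ (j : Fin b) → ¬ j ≡ i → ∃ λ u → Adj G v u × c u ≡ j))

HasBColoring : Graph → ℕ → Set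
HasBColoring G b = Σ (Fin (n G) → Fin b) λ c → IsBColoring G b c

BChromaticNumber : Graph → ℕ → Set
BChromaticNumber G b = HasBColoring G b × (∀ m → HasBColoring G m → m ≤ b)

{-# OPTIONS --safe #-}
-- The graph is a union of k cliques ("groups") of size (2k-1)q, plus edges between
-- groups. Group a holds kq vertices U a d r (d < k, r < q) and, for every label c ≠ a,
-- q vertices H c e r with a = punchIn c e. Across groups, two U-vertices are adjacent
-- when one of them has d = 0, a U-vertex of group a and an H-vertex labelled c are
-- adjacent iff a ≠ c, and two H-vertices are never adjacent.
-- One H-vertex per group is independent, so θ = k. Colouring U a 0 r and H a e r by
-- (a, r) and U a (1+d) r by (d, r) is proper, and the vertices U a 0 r and U 0 (1+d) r
-- form a clique meeting all (2k-1)q colours, so ω = (2k-1)q. Colouring every U-vertex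
-- by itself and H c e r like U c (1+e) r is a b-colouring with k²q colours. Conversely
-- a b-colouring has at most |U| = k²q colours unless some b-vertex x is an H-vertex
-- labelled c; then the closed neighbourhood of x meets every colour, and it embeds
-- into U: no U-neighbour of x lies in group c, and an H-neighbour H c' e' r' of x is
-- sent to U c c' r'.
module Submission where

open import Defs hiding (sym)
open import Data.Nat using (ℕ; zero; suc; _+_; _*_; _∸_; _≤_; s≤s)
open import Data.Nat.Divisibility using (_∣_; divides)
import Data.Nat.Properties as ℕ
open import Data.Fin using (Fin; zero; suc; punchIn; _≟_)
open import Data.Fin.Properties using (any?; injective⇒≤; punchIn-injective; punchInᵢ≢i; +↔⊎; *↔×)
open import Data.Product using (Σ; ∃; _×_; _,_; proj₁; proj₂)
open import Data.Product.Function.NonDependent.Propositional using (_×-↔_)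
open import Data.Sum using (_⊎_; inj₁; inj₂)
open import Data.Sum.Function.Propositional using (_⊎-↔_)
open import Data.Sum.Properties using (inj₁-injective)
open import Data.Empty using (⊥)
open import Function using (_∘_; Injective; _↔_; Inverse)
open import Function.Properties.Inverse using (↔-refl; ↔-trans)
open import Relation.Binary.PropositionalEquality
  using (_≡_; _≢_; refl; sym; trans; cong; subst; subst₂; module ≡-Reasoning)
open import Relation.Nullary using (¬_; yes; no; contradiction)
open import Relation.Nullary.Decidable using (decidable-stable)
open import Relation.Unary using (Decidable)

InjectiveOn : {A B : Set} → (A → Set) → (A → B) → Set
InjectiveOn S f = ∀ {x y} → S x → S y → f x ≡ f y → x ≡ y

retraction⇒injective : {A B : Set} {f : A → B} (g : B → A) →
  (∀ x → g (f x) ≡ x) → Injective _≡_ _≡_ f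
retraction⇒injective g gf {x} {y} fx≡fy = trans (sym (gf x)) (trans (cong g fx≡fy) (gf y))

↔-to-injective : {A B : Set} (e : A ↔ B) → Injective _≡_ _≡_ (Inverse.to e)
↔-to-injective e = retraction⇒injective (Inverse.from e) (Inverse.strictlyInverseʳ e)

↔-from-injective : {A B : Set} (e : A ↔ B) → Injective _≡_ _≡_ (Inverse.from e)
↔-from-injective e = retraction⇒injective (Inverse.to e) (Inverse.strictlyInverseˡ e)

≢-preserving⇒≤ : ∀ {a b} (f : Fin a → Fin b) → (∀ {i j} → i ≢ j → f i ≢ f j) → a ≤ b
≢-preserving⇒≤ f pres = injective⇒≤ {f = f} λ {i} {j} fi≡fj →
  decidable-stable (i ≟ j) λ i≢j → pres i≢j fi≡fj

meetsAllColours⇒≤ : ∀ {A : Set} {a b} (c : A → Fin a) (S : A → Set) →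
  (∀ i → ∃ λ x → S x × c x ≡ i) → (f : A → Fin b) → InjectiveOn S f → a ≤ b
meetsAllColours⇒≤ c S meets f f-inj = injective⇒≤ {f = f ∘ proj₁ ∘ meets} λ {i} {j} e →
  let _ , Sx , cx≡i = meets i
      _ , Sy , cy≡j = meets j
  in trans (sym cx≡i) (trans (cong c (f-inj Sx Sy e)) cy≡j)

module _ (G : Graph) where

  ClosedNeighbour : Fin (n G) → Fin (n G) → Set
  ClosedNeighbour v u = u ≡ v ⊎ Adj G v u

  clique≤colours : ∀ {w m} (c : Fin (n G) → Fin w) →
    (∀ u v → Adj G u v → c u ≢ c v) → HasCliqueOfSize G m → m ≤ w
  clique≤colours c proper (f , clique) =
    ≢-preserving⇒≤ (c ∘ f) λ i≢j → proper _ _ (clique _ _ i≢j)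

  independent≤cliquePartition : ∀ {m k} (f : Fin m → Fin (n G)) → Injective _≡_ _≡_ f →
    (∀ i j → ¬ Adj G (f i) (f j)) → HasCliquePartition G k → m ≤ k
  independent≤cliquePartition f f-inj independent (p , cover , _) =
    ≢-preserving⇒≤ (p ∘ f) λ i≢j same → independent _ _ (cover _ _ same (i≢j ∘ f-inj))

  closedNeighbourhood-meetsAllColours : ∀ {b} {c : Fin (n G) → Fin b} {v i} → c v ≡ i →
    (∀ j → j ≢ i → ∃ λ u → Adj G v u × c u ≡ j) →
    ∀ j → ∃ λ u → ClosedNeighbour v u × c u ≡ j
  closedNeighbourhood-meetsAllColours {v = v} {i} cv≡i dominates j with j ≟ i
  ... | yes refl = v , inj₁ refl , cv≡i
  ... | no j≢i   = let u , v~u , cu≡j = dominates j j≢i in u , inj₂ v~u , cu≡j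

  -- Either no b-vertex lies in P, and f separates the b-vertices, or the closed
  -- neighbourhood of a b-vertex in P meets every colour class.
  bChromatic≤ : ∀ {m b} (P : Fin (n G) → Set) → Decidable P →
    (f : Fin (n G) → Fin b) → InjectiveOn (¬_ ∘ P) f →
    (∀ v → P v → ∃ λ (g : Fin (n G) → Fin b) → InjectiveOn (ClosedNeighbour v) g) →
    HasBColoring G m → m ≤ b
  bChromatic≤ P P? f f-inj nbhd-inj (c , _ , _ , bVertex) with any? (P? ∘ proj₁ ∘ bVertex)
  ... | yes (i , Pv) =
    let g , g-inj = nbhd-inj _ Pv
        _ , cv≡i , dominates = bVertex i
    in meetsAllColours⇒≤ c (ClosedNeighbour _)
         (closedNeighbourhood-meetsAllColours cv≡i dominates) g g-inj
  ... | no ¬P = meetsAllColours⇒≤ c (¬_ ∘ P)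
    (λ i → proj₁ (bVertex i) , (λ Pv → ¬P (i , Pv)) , proj₁ (proj₂ (bVertex i))) f f-inj

module EnumeratedGraph {V : Set} {N : ℕ} (enum : Fin N ↔ V) (_~_ : V → V → Set)
  (~-sym : ∀ {x y} → x ~ y → y ~ x) (~-irrefl : ∀ {x} → ¬ x ~ x) where

  open Inverse enum using (to; from; strictlyInverseˡ)

  graph : Graph
  graph = record { n = N ; Adj = λ u v → to u ~ to v ; sym = ~-sym ; irrefl = ~-irrefl }

  adj-from : ∀ {x y} → x ~ y → Adj graph (from x) (from y)
  adj-from = subst₂ _~_ (sym (strictlyInverseˡ _)) (sym (strictlyInverseˡ _))

  adj-from⁻ : ∀ {x y} → Adj graph (from x) (from y) → x ~ y
  adj-from⁻ = subst₂ _~_ (strictlyInverseˡ _) (strictlyInverseˡ _)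

  cliqueCoverNumber : ∀ {k} (π : V → Fin k) → (∀ x y → π x ≡ π y → x ≢ y → x ~ y) →
    (τ : Fin k → V) → (∀ i → π (τ i) ≡ i) → (∀ i j → ¬ τ i ~ τ j) →
    CliqueCoverNumber graph k
  cliqueCoverNumber π π-clique τ π∘τ τ-independent =
    (π ∘ to , (λ u v same u≢v → π-clique _ _ same (u≢v ∘ ↔-to-injective enum))
            , λ i → from (τ i) , πτ i)
    , λ _ → independent≤cliquePartition graph (from ∘ τ) (retraction⇒injective (π ∘ to) πτ)
              λ i j → τ-independent i j ∘ adj-from⁻
    where
    πτ : ∀ i → π (to (from (τ i))) ≡ i
    πτ i = trans (cong π (strictlyInverseˡ (τ i))) (π∘τ i)

  module _ {C : Set} {b : ℕ} (colours : Fin b ↔ C) where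

    private module Colours = Inverse colours

    encode : (V → C) → Fin N → Fin b
    encode χ = Colours.from ∘ χ ∘ to

    encode-injectiveOn : ∀ {S χ} → InjectiveOn S χ → InjectiveOn (S ∘ to) (encode χ)
    encode-injectiveOn χ-inj Su Sv = ↔-to-injective enum ∘ χ-inj Su Sv ∘ ↔-from-injective colours

    encode-proper : ∀ {χ} → (∀ {x y} → x ~ y → χ x ≢ χ y) →
      ∀ u v → Adj graph u v → encode χ u ≢ encode χ v
    encode-proper χ-proper _ _ u~v = χ-proper u~v ∘ ↔-from-injective colours

    encode-from : ∀ χ {x i} → χ x ≡ Colours.to i → encode χ (from x) ≡ i
    encode-from χ {x} {i} χx≡i = begin
      Colours.from (χ (to (from x))) ≡⟨ cong (Colours.from ∘ χ) (strictlyInverseˡ x) ⟩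
      Colours.from (χ x)             ≡⟨ cong Colours.from χx≡i ⟩
      Colours.from (Colours.to i)    ≡⟨ Colours.strictlyInverseʳ i ⟩
      i                              ∎
      where open ≡-Reasoning

    cliqueNumber : (χ : V → C) → (∀ {x y} → x ~ y → χ x ≢ χ y) →
      (κ : C → V) → (∀ γ γ' → γ ≢ γ' → κ γ ~ κ γ') → CliqueNumber graph b
    cliqueNumber χ χ-proper κ κ-clique =
      (from ∘ κ ∘ Colours.to , λ i j i≢j → adj-from (κ-clique _ _ (i≢j ∘ ↔-to-injective colours)))
      , λ _ → clique≤colours graph (encode χ) (encode-proper χ-proper)

    isBColoring : (χ : V → C) → (∀ {x y} → x ~ y → χ x ≢ χ y) →
      (β : C → V) → (∀ γ → χ (β γ) ≡ γ) →
      (∀ γ γ' → γ' ≢ γ → ∃ λ z → β γ ~ z × χ z ≡ γ') → IsBColoring graph b (encode χ)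
    isBColoring χ χ-proper β χ∘β dominates =
      encode-proper χ-proper , (λ i → bVertex i , proj₁ (bVertex-dominates i))
      , λ i → bVertex i , bVertex-dominates i
      where
      bVertex : Fin b → Fin N
      bVertex i = from (β (Colours.to i))
      bVertex-dominates : ∀ i → encode χ (bVertex i) ≡ i
        × (∀ j → j ≢ i → ∃ λ u → Adj graph (bVertex i) u × encode χ u ≡ j)
      bVertex-dominates i = encode-from χ (χ∘β _) , λ j j≢i →
        let z , βi~z , χz≡j =
              dominates (Colours.to i) (Colours.to j) (j≢i ∘ ↔-to-injective colours)
        in from z , adj-from βi~z , encode-from χ χz≡j

module Construction (m p : ℕ) where

  k₁ : ℕ
  k₁ = suc m
  k : ℕ
  k = suc k₁
  q : ℕ
  q = suc p

  UVertex : Set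
  UVertex = (Fin k × Fin k) × Fin q
  HVertex : Set
  HVertex = (Fin k × Fin k₁) × Fin q
  Vertex : Set
  Vertex = UVertex ⊎ HVertex

  pattern U a d r = inj₁ ((a , d) , r)
  pattern H c e r = inj₂ ((c , e) , r)

  group : Vertex → Fin k
  group (U a _ _) = a
  group (H c e _) = punchIn c e

  Cross : Vertex → Vertex → Set
  Cross (U _ d _) (U _ d' _) = d ≡ zero ⊎ d' ≡ zero
  Cross (U a _ _) (H c e _) = a ≢ c × a ≢ punchIn c e
  Cross (H c e _) (U a _ _) = a ≢ c × a ≢ punchIn c e
  Cross (inj₂ _)  (inj₂ _)  = ⊥

  data Near (x y : Vertex) : Set where
    same-group : group x ≡ group y → Near x y
    cross      : Cross x y → Near x y

  Near-refl : ∀ {x} → Near x x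
  Near-refl = same-group refl

  Near-sym : ∀ {x y} → Near x y → Near y x
  Near-sym (same-group same) = same-group (sym same)
  Near-sym {U _ _ _} {U _ _ _} (cross (inj₁ d≡0))  = cross (inj₂ d≡0)
  Near-sym {U _ _ _} {U _ _ _} (cross (inj₂ d'≡0)) = cross (inj₁ d'≡0)
  Near-sym {U _ _ _} {H _ _ _} (cross c) = cross c
  Near-sym {H _ _ _} {U _ _ _} (cross c) = cross c

  _~_ : Vertex → Vertex → Set
  x ~ y = x ≢ y × Near x y

  ~-sym : ∀ {x y} → x ~ y → y ~ x
  ~-sym (x≢y , near) = x≢y ∘ sym , Near-sym near

  ~-irrefl : ∀ {x} → ¬ x ~ x
  ~-irrefl (x≢x , _) = x≢x refl

  near-U-H : ∀ {a d r c e r'} → a ≢ c → Near (U a d r) (H c e r')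
  near-U-H {a} {c = c} {e} a≢c with a ≟ punchIn c e
  ... | yes a≡g = same-group a≡g
  ... | no a≢g  = cross (a≢c , a≢g)

  ¬near-U-H : ∀ {c d r e r'} → ¬ Near (U c d r) (H c e r')
  ¬near-U-H {c} {e = e} (same-group c≡g) = punchInᵢ≢i c e (sym c≡g)
  ¬near-U-H (cross (c≢c , _)) = c≢c refl

  uEnum : Fin (k * k * q) ↔ UVertex
  uEnum = ↔-trans *↔× (*↔× ×-↔ ↔-refl)

  hEnum : Fin (k * k₁ * q) ↔ HVertex
  hEnum = ↔-trans *↔× (*↔× ×-↔ ↔-refl)

  vEnum : Fin (k * k * q + k * k₁ * q) ↔ Vertex
  vEnum = ↔-trans +↔⊎ (uEnum ⊎-↔ hEnum)

  open EnumeratedGraph vEnum _~_ ~-sym ~-irrefl public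
  open Inverse vEnum using (to)

  transversal : Fin k → Vertex
  transversal zero    = H (suc zero) zero zero
  transversal (suc a) = H zero a zero

  group∘transversal : ∀ a → group (transversal a) ≡ a
  group∘transversal zero    = refl
  group∘transversal (suc a) = refl

  transversal-independent : ∀ a b → ¬ transversal a ~ transversal b
  transversal-independent a b (t≢t , same-group same) =
    t≢t (cong transversal (trans (sym (group∘transversal a)) (trans same (group∘transversal b))))
  transversal-independent zero    zero    (_ , cross ())
  transversal-independent zero    (suc _) (_ , cross ())
  transversal-independent (suc _) zero    (_ , cross ())
  transversal-independent (suc _) (suc _) (_ , cross ())

  graph-cliqueCoverNumber : CliqueCoverNumber graph k
  graph-cliqueCoverNumber = cliqueCoverNumber group (λ _ _ same x≢y → x≢y , same-group same)
    transversal group∘transversal transversal-independent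

  CliqueColour : Set
  CliqueColour = (Fin k ⊎ Fin k₁) × Fin q

  cliqueColour : Vertex → CliqueColour
  cliqueColour (U a zero r)    = inj₁ a , r
  cliqueColour (U _ (suc d) r) = inj₂ d , r
  cliqueColour (H c _ r)       = inj₁ c , r

  cliqueColour-proper : ∀ {x y} → x ~ y → cliqueColour x ≢ cliqueColour y
  cliqueColour-proper {U _ zero _}    {U _ zero _}    (x≢y , _) refl = x≢y refl
  cliqueColour-proper {U _ zero _}    {U _ (suc _) _} _ ()
  cliqueColour-proper {U _ (suc _) _} {U _ zero _}    _ ()
  cliqueColour-proper {U _ (suc _) _} {U _ (suc _) _} (x≢y , same-group refl) refl = x≢y refl
  cliqueColour-proper {U _ (suc _) _} {U _ (suc _) _} (_ , cross (inj₁ ())) refl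
  cliqueColour-proper {U _ (suc _) _} {U _ (suc _) _} (_ , cross (inj₂ ())) refl
  cliqueColour-proper {U _ zero _}    {H _ _ _}       (_ , near) refl = ¬near-U-H near
  cliqueColour-proper {U _ (suc _) _} {H _ _ _}       _ ()
  cliqueColour-proper {H _ _ _}       {U _ zero _}    (_ , near) refl = ¬near-U-H (Near-sym near)
  cliqueColour-proper {H _ _ _}       {U _ (suc _) _} _ ()
  cliqueColour-proper {H c e _}       {H _ e' _}      (x≢y , same-group same) refl
    with punchIn-injective c e e' same
  ... | refl = x≢y refl

  cliqueVertex : CliqueColour → Vertex
  cliqueVertex (inj₁ a , r) = U a zero r
  cliqueVertex (inj₂ d , r) = U zero (suc d) r

  cliqueColour∘cliqueVertex : ∀ γ → cliqueColour (cliqueVertex γ) ≡ γ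
  cliqueColour∘cliqueVertex (inj₁ _ , _) = refl
  cliqueColour∘cliqueVertex (inj₂ _ , _) = refl

  cliqueVertex-near : ∀ γ γ' → Near (cliqueVertex γ) (cliqueVertex γ')
  cliqueVertex-near (inj₁ _ , _) (inj₁ _ , _) = cross (inj₁ refl)
  cliqueVertex-near (inj₁ _ , _) (inj₂ _ , _) = cross (inj₁ refl)
  cliqueVertex-near (inj₂ _ , _) (inj₁ _ , _) = cross (inj₂ refl)
  cliqueVertex-near (inj₂ _ , _) (inj₂ _ , _) = same-group refl

  cliqueColourEnum : Fin ((k + k₁) * q) ↔ CliqueColour
  cliqueColourEnum = ↔-trans *↔× (+↔⊎ ×-↔ ↔-refl)

  graph-cliqueNumber : CliqueNumber graph ((k + k₁) * q)
  graph-cliqueNumber = cliqueNumber cliqueColourEnum cliqueColour cliqueColour-proper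
    cliqueVertex λ γ γ' γ≢γ' →
      γ≢γ' ∘ retraction⇒injective cliqueColour cliqueColour∘cliqueVertex , cliqueVertex-near γ γ'

  bColour : Vertex → UVertex
  bColour (inj₁ u)  = u
  bColour (H c e r) = (c , suc e) , r

  bColour-proper : ∀ {x y} → x ~ y → bColour x ≢ bColour y
  bColour-proper {inj₁ _}  {inj₁ _}  (x≢y , _) refl = x≢y refl
  bColour-proper {inj₁ _}  {H _ _ _} (_ , near) refl = ¬near-U-H near
  bColour-proper {H _ _ _} {inj₁ _}  (_ , near) refl = ¬near-U-H (Near-sym near)
  bColour-proper {H _ _ _} {H _ _ _} (x≢y , _) refl = x≢y refl

  bColour-dominates : ∀ u v → v ≢ u → ∃ λ z → inj₁ u ~ z × bColour z ≡ v
  bColour-dominates ((a , _) , _) ((a' , _) , _) v≢u with a ≟ a'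
  ... | yes refl = inj₁ _ , (v≢u ∘ sym ∘ inj₁-injective , same-group refl) , refl
  bColour-dominates _ ((_ , zero) , _) _ | no a≢a' =
    inj₁ _ , (a≢a' ∘ cong group , cross (inj₂ refl)) , refl
  bColour-dominates _ ((a' , suc e) , r') _ | no a≢a' =
    H a' e r' , ((λ ()) , near-U-H a≢a') , refl

  IsHVertex : Vertex → Set
  IsHVertex x = ∃ λ h → x ≡ inj₂ h

  isHVertex? : Decidable IsHVertex
  isHVertex? (inj₁ _) = no λ ()
  isHVertex? (inj₂ h) = yes (h , refl)

  bColour-injectiveOn-U : InjectiveOn (¬_ ∘ IsHVertex) bColour
  bColour-injectiveOn-U {inj₁ _} {inj₁ _} _ _ refl = refl
  bColour-injectiveOn-U {inj₁ _} {inj₂ h} _ ¬H _ = contradiction (h , refl) ¬H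
  bColour-injectiveOn-U {inj₂ h} ¬H _ _ = contradiction (h , refl) ¬H

  neighbourCode : HVertex → Vertex → UVertex
  neighbourCode _ (inj₁ u) = u
  neighbourCode ((c , _) , _) (H c' _ r') = (c , c') , r'

  neighbourCode-injectiveOn : ∀ h → InjectiveOn (Near (inj₂ h)) (neighbourCode h)
  neighbourCode-injectiveOn _ {inj₁ _}  {inj₁ _}  _ _ refl = refl
  neighbourCode-injectiveOn _ {inj₁ _}  {H _ _ _} near _ refl =
    contradiction (Near-sym near) ¬near-U-H
  neighbourCode-injectiveOn _ {H _ _ _} {inj₁ _}  _ near refl =
    contradiction (Near-sym near) ¬near-U-H
  neighbourCode-injectiveOn _ {H c' e' _} {H _ e'' _} (same-group g≡g') (same-group g≡g'') refl
    with punchIn-injective c' e' e'' (trans (sym g≡g') g≡g'')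
  ... | refl = refl

  closedNeighbour⇒Near : ∀ {u v} → ClosedNeighbour graph v u → Near (to v) (to u)
  closedNeighbour⇒Near (inj₁ refl) = Near-refl
  closedNeighbour⇒Near (inj₂ (_ , near)) = near

  graph-bChromaticNumber : BChromaticNumber graph (k * k * q)
  graph-bChromaticNumber =
    (encode uEnum bColour
      , isBColoring uEnum bColour bColour-proper inj₁ (λ _ → refl) bColour-dominates)
    , λ _ → bChromatic≤ graph (IsHVertex ∘ to) (isHVertex? ∘ to)
              (encode uEnum bColour) (encode-injectiveOn uEnum bColour-injectiveOn-U)
              closedNeighbourhood-injective
    where
    closedNeighbourhood-injective : ∀ v → IsHVertex (to v) →
      ∃ λ (g : Fin (n graph) → Fin (k * k * q)) → InjectiveOn (ClosedNeighbour graph v) g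
    closedNeighbourhood-injective v (h , v≡h) = encode uEnum (neighbourCode h) ,
      λ u∈N w∈N → encode-injectiveOn uEnum (neighbourCode-injectiveOn h) (near u∈N) (near w∈N)
      where
      near : ∀ {u} → ClosedNeighbour graph v u → Near (inj₂ h) (to u)
      near {u} = subst (λ x → Near x (to u)) v≡h ∘ closedNeighbour⇒Near

2*[1+n]∸1≡1+n+n : ∀ n → 2 * suc n ∸ 1 ≡ suc n + n
2*[1+n]∸1≡1+n+n n = begin
  n + suc (n + 0)   ≡⟨ ℕ.+-suc n (n + 0) ⟩
  suc (n + (n + 0)) ≡⟨ cong (λ t → suc (n + t)) (ℕ.+-identityʳ n) ⟩
  suc n + n         ∎
  where open ≡-Reasoning

mainTheorem5 : (k w : ℕ) → 2 ≤ k → 1 ≤ w → (2 * k ∸ 1) ∣ w →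
    Σ Graph λ G → CliqueCoverNumber G k × CliqueNumber G w
      × (∀ q → w ≡ q * (2 * k ∸ 1) → BChromaticNumber G (k * k * q))
mainTheorem5 (suc (suc m)) .0 (s≤s (s≤s _)) () (divides zero refl)
mainTheorem5 (suc (suc m)) w (s≤s (s≤s _)) _ (divides (suc p) w≡q[2k∸1]) =
  graph , graph-cliqueCoverNumber , subst (CliqueNumber graph) cliqueSize≡w graph-cliqueNumber
  , λ q' w≡q'[2k∸1] →
      subst (λ t → BChromaticNumber graph (k * k * t))
        (ℕ.*-cancelʳ-≡ q q' (2 * k ∸ 1) (trans (sym w≡q[2k∸1]) w≡q'[2k∸1]))
        graph-bChromaticNumber
  where
  open Construction m p
  open ≡-Reasoning
  cliqueSize≡w : (k + k₁) * q ≡ w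
  cliqueSize≡w = begin
    (k + k₁) * q      ≡⟨ ℕ.*-comm (k + k₁) q ⟩
    q * (k + k₁)      ≡⟨ cong (q *_) (sym (2*[1+n]∸1≡1+n+n k₁)) ⟩
    q * (2 * k ∸ 1)   ≡⟨ sym w≡q[2k∸1] ⟩
    w                 ∎
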